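{- Let $k, n \ge 1$ and let $a_1,\dots,a_k$ be non-negative integers with $\sum_{i=1}^{k} a_i = n$ and $\sum_{i=1}^{k}\sum_{j=0}^{a_i-1} 2^j \le 2^k - 1$. Then $k \ge \max\left(\sqrt{n},\ \sqrt{n} + \tfrac{1}{4}\log_2 n - \tfrac{1}{2}\right)$. -}

module Defs where

open import Data.Nat using (ℕ; _+_; _*_; _^_; _≤_; _<_)
open import Data.List using (upTo)
import Data.List as List
open import Data.Nat.ListAction using () renaming (sum to lsum)

geom : ℕ → ℕ
geom a = lsum (List.map (2 ^_) (upTo a))

-- RealBound k n  encodes the real inequality
--     k ≥ √n + (1/4) log₂ n − 1/2,   i.e.   4√n + log₂ n ≤ 4k + 2,
-- for n ≥ 1, without real numbers: for all non-negative rationals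
-- u = a/b ≤ 4√n  (a² ≤ 16 n b²)  and  v = c/d ≤ log₂ n  (2^c ≤ n^d),
-- we have u + v ≤ 4k + 2.  Since 4√n and log₂ n are ≥ 0 (n ≥ 1) they are
-- the suprema of such u, v, so this is equivalent to the real inequality.
RealBound : ℕ → ℕ → Set
RealBound k n =
  ∀ (a b c d : ℕ) → 0 < b → 0 < d →
  a * a ≤ 16 * n * (b * b) →
  2 ^ c ≤ n ^ d →
  a * d + c * b ≤ (4 * k + 2) * (b * d)

{-# OPTIONS --safe #-}
module Submission where

-- On the integers 2^x lies above the line through (p, 2^p) and (p + 1, 2^(p+1)), that is
-- (1 + x) 2^p ≤ 2^x + p 2^p. Summed over the a_i, this shows that Σ 2^(a_i) < (k + 1) 2^p
-- forces n = Σ a_i ≤ k p. Take j = ⌊log₂ k⌋ and p = k − j: then k ≤ 2^p and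
-- 2^k = 2^j 2^p ≤ k 2^p, while the hypothesis reads Σ 2^(a_i) = Σ (geom a_i + 1) ≤ 2^k − 1 + k,
-- so n ≤ k p ≤ k². Finally √n ≤ √(k p) ≤ (k + p)/2 by AM-GM, log₂ n ≤ log₂ k² ≤ 2 (j + 1),
-- and 2 (k + p) + 2 (j + 1) = 4k + 2.

open import Defs
open import Data.Nat using (ℕ; _+_; _*_; _^_; _≤_; _∸_)
open import Data.Vec using (Vec; sum; map)
open import Data.Product using (_×_)
open import Relation.Binary.PropositionalEquality using (_≡_)

open import Data.Nat using (zero; suc; _<_; z≤n; s≤s; s≤s⁻¹; _≤?_)
open import Data.Nat.Properties
open import Data.Nat.Tactic.RingSolver using (solve-∀)
open import Data.Nat.ListAction using () renaming (sum to lsum)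
open import Data.Nat.ListAction.Properties using () renaming (sum-++ to lsum-++)
open import Data.List using (upTo; [_]; _∷ʳ_)
import Data.List as List
open import Data.List.Properties using (applyUpTo-∷ʳ; map-++)
open import Data.Vec using ([]; _∷_)
open import Data.Product using (_,_; ∃-syntax)
open import Function using (id; _∘_)
open import Relation.Nullary using (yes; no)
open import Relation.Binary.PropositionalEquality using (refl; sym; cong; cong₂; subst; module ≡-Reasoning)

n<2^n : ∀ n → n < 2 ^ n
n<2^n zero    = s≤s z≤n
n<2^n (suc n) = begin
  1 + suc n        ≤⟨ +-mono-≤ (m^n>0 2 n) (n<2^n n) ⟩
  2 ^ n + 2 ^ n    ≡⟨ cong (2 ^ n +_) (sym (+-identityʳ (2 ^ n))) ⟩
  2 ^ suc n        ∎
  where open ≤-Reasoning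

2*n≤2^n : ∀ n → 2 * n ≤ 2 ^ n
2*n≤2^n zero    = z≤n
2*n≤2^n (suc n) = *-monoʳ-≤ 2 (n<2^n n)

2^m≤n⇒m<n : ∀ {m n} → 2 ^ m ≤ n → m < n
2^m≤n⇒m<n {m} = <-≤-trans (n<2^n m)

2^m≤2^n⇒m≤n : ∀ {m n} → 2 ^ m ≤ 2 ^ n → m ≤ n
2^m≤2^n⇒m≤n 2^m≤2^n = ≮⇒≥ λ n<m → <⇒≱ (^-monoʳ-< 2 (s≤s (s≤s z≤n)) n<m) 2^m≤2^n

m*m≤n*n⇒m≤n : ∀ {m n} → m * m ≤ n * n → m ≤ n
m*m≤n*n⇒m≤n m²≤n² = ≮⇒≥ λ n<m → <⇒≱ (*-mono-< n<m n<m) m²≤n²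

4*m*n≤[m+n]² : ∀ m n → 4 * (m * n) ≤ (m + n) * (m + n)
4*m*n≤[m+n]² zero    n       = z≤n
4*m*n≤[m+n]² (suc m) zero    = ≤-trans (≤-reflexive (cong (4 *_) (*-zeroʳ (suc m)))) z≤n
4*m*n≤[m+n]² (suc m) (suc n) = begin
  4 * (suc m * suc n)                       ≡⟨ lhs m n ⟩
  4 * (m * n) + 4 * (m + n) + 4             ≤⟨ +-monoˡ-≤ 4 (+-monoˡ-≤ (4 * (m + n)) (4*m*n≤[m+n]² m n)) ⟩
  (m + n) * (m + n) + 4 * (m + n) + 4       ≡⟨ rhs m n ⟩
  (suc m + suc n) * (suc m + suc n)         ∎
  where
  open ≤-Reasoning
  lhs : ∀ m n → 4 * (suc m * suc n) ≡ 4 * (m * n) + 4 * (m + n) + 4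
  lhs = solve-∀
  rhs : ∀ m n → (m + n) * (m + n) + 4 * (m + n) + 4 ≡ (suc m + suc n) * (suc m + suc n)
  rhs = solve-∀

log₂-bracket : ∀ {k} → 1 ≤ k → ∃[ j ] 2 ^ j ≤ k × k ≤ 2 ^ suc j
log₂-bracket {suc zero}    _ = 0 , ≤-refl , s≤s z≤n
log₂-bracket {suc (suc k)} _ with log₂-bracket {suc k} (s≤s z≤n)
... | j , 2^j≤1+k , 1+k≤2^[1+j] with 2 + k ≤? 2 ^ suc j
...   | yes 2+k≤2^[1+j] = j , m≤n⇒m≤1+n 2^j≤1+k , 2+k≤2^[1+j]
...   | no  2+k≰2^[1+j] = suc j , <⇒≤ (≰⇒> 2+k≰2^[1+j]) , (begin
  2 + k                      ≤⟨ s≤s 1+k≤2^[1+j] ⟩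
  1 + 2 ^ suc j              ≤⟨ +-monoˡ-≤ (2 ^ suc j) (m^n>0 2 (suc j)) ⟩
  2 ^ suc j + 2 ^ suc j      ≡⟨ cong (2 ^ suc j +_) (sym (+-identityʳ (2 ^ suc j))) ⟩
  2 ^ suc (suc j)            ∎)
  where open ≤-Reasoning

2^j≤k⇒k≤2^[k∸j] : ∀ {j k} → 2 ^ j ≤ k → k ≤ 2 ^ (k ∸ j)
2^j≤k⇒k≤2^[k∸j] {j} {k} 2^j≤k = begin
  k                    ≤⟨ m≤n+m∸n k j ⟩
  j + (k ∸ j)          ≤⟨ +-monoˡ-≤ (k ∸ j) j≤k∸j ⟩
  (k ∸ j) + (k ∸ j)    ≡⟨ cong ((k ∸ j) +_) (sym (+-identityʳ (k ∸ j))) ⟩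
  2 * (k ∸ j)          ≤⟨ 2*n≤2^n (k ∸ j) ⟩
  2 ^ (k ∸ j)          ∎
  where
  open ≤-Reasoning
  j≤k∸j : j ≤ k ∸ j
  j≤k∸j = m+n≤o⇒m≤o∸n j (begin
    j + j                ≡⟨ cong (j +_) (sym (+-identityʳ j)) ⟩
    2 * j                ≤⟨ 2*n≤2^n j ⟩
    2 ^ j                ≤⟨ 2^j≤k ⟩
    k                    ∎)

geom-suc : ∀ a → geom (suc a) ≡ geom a + 2 ^ a
geom-suc a = begin
  lsum (List.map (2 ^_) (upTo (suc a)))           ≡⟨ cong (lsum ∘ List.map (2 ^_)) (sym (applyUpTo-∷ʳ id a)) ⟩
  lsum (List.map (2 ^_) (upTo a ∷ʳ a))            ≡⟨ cong lsum (map-++ (2 ^_) (upTo a) [ a ]) ⟩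
  lsum (List.map (2 ^_) (upTo a) List.++ [ 2 ^ a ]) ≡⟨ lsum-++ (List.map (2 ^_) (upTo a)) [ 2 ^ a ] ⟩
  geom a + (2 ^ a + 0)                            ≡⟨ cong (geom a +_) (+-identityʳ (2 ^ a)) ⟩
  geom a + 2 ^ a                                  ∎
  where open ≡-Reasoning

geom+1≡2^ : ∀ a → geom a + 1 ≡ 2 ^ a
geom+1≡2^ zero    = refl
geom+1≡2^ (suc a) = begin
  geom (suc a) + 1       ≡⟨ cong (_+ 1) (geom-suc a) ⟩
  geom a + 2 ^ a + 1     ≡⟨ regroup (geom a) (2 ^ a) ⟩
  geom a + 1 + 2 ^ a     ≡⟨ cong (_+ 2 ^ a) (geom+1≡2^ a) ⟩
  2 ^ a + 2 ^ a          ≡⟨ cong (2 ^ a +_) (sym (+-identityʳ (2 ^ a))) ⟩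
  2 ^ suc a              ∎
  where
  open ≡-Reasoning
  regroup : ∀ g X → g + X + 1 ≡ g + 1 + X
  regroup = solve-∀

sum-geom+length≡sum-2^ : ∀ {k} (a : Vec ℕ k) → sum (map geom a) + k ≡ sum (map (2 ^_) a)
sum-geom+length≡sum-2^ []               = refl
sum-geom+length≡sum-2^ {suc k} (x ∷ a) = begin
  geom x + sum (map geom a) + suc k      ≡⟨ regroup (geom x) (sum (map geom a)) k ⟩
  (geom x + 1) + (sum (map geom a) + k)  ≡⟨ cong₂ _+_ (geom+1≡2^ x) (sum-geom+length≡sum-2^ a) ⟩
  2 ^ x + sum (map (2 ^_) a)             ∎
  where
  open ≡-Reasoning
  regroup : ∀ g G k → g + G + suc k ≡ (g + 1) + (G + k)
  regroup = solve-∀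

[1+x]*2^p≤2^x+p*2^p : ∀ x p → suc x * 2 ^ p ≤ 2 ^ x + p * 2 ^ p
[1+x]*2^p≤2^x+p*2^p zero    zero    = ≤-refl
[1+x]*2^p≤2^x+p*2^p zero    (suc p) = begin
  1 * 2 ^ suc p                   ≡⟨ *-identityˡ (2 ^ suc p) ⟩
  2 ^ suc p                       ≤⟨ m≤m+n (2 ^ suc p) (p * 2 ^ suc p) ⟩
  suc p * 2 ^ suc p               ≤⟨ n≤1+n (suc p * 2 ^ suc p) ⟩
  1 + suc p * 2 ^ suc p           ∎
  where open ≤-Reasoning
[1+x]*2^p≤2^x+p*2^p (suc x) zero    = begin
  suc (suc x) * 1                 ≡⟨ *-identityʳ (suc (suc x)) ⟩
  suc (suc x)                     ≤⟨ n<2^n (suc x) ⟩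
  2 ^ suc x                       ≡⟨ sym (+-identityʳ (2 ^ suc x)) ⟩
  2 ^ suc x + 0                   ∎
  where open ≤-Reasoning
[1+x]*2^p≤2^x+p*2^p (suc x) (suc p) = begin
  (2 + x) * (2 * P)               ≡⟨ double x P ⟩
  2 * ((1 + x) * P) + 2 * P       ≤⟨ +-monoˡ-≤ (2 * P) (*-monoʳ-≤ 2 ([1+x]*2^p≤2^x+p*2^p x p)) ⟩
  2 * (2 ^ x + p * P) + 2 * P     ≡⟨ undouble (2 ^ x) p P ⟩
  2 * 2 ^ x + (1 + p) * (2 * P)   ∎
  where
  open ≤-Reasoning
  P = 2 ^ p
  double : ∀ x P → (2 + x) * (2 * P) ≡ 2 * ((1 + x) * P) + 2 * P
  double = solve-∀
  undouble : ∀ X p P → 2 * (X + p * P) + 2 * P ≡ 2 * X + (1 + p) * (2 * P)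
  undouble = solve-∀

[sum+length]*2^p≤sum-2^+length*p*2^p : ∀ {k} (a : Vec ℕ k) p →
  (sum a + k) * 2 ^ p ≤ sum (map (2 ^_) a) + k * p * 2 ^ p
[sum+length]*2^p≤sum-2^+length*p*2^p []               p = z≤n
[sum+length]*2^p≤sum-2^+length*p*2^p {suc k} (x ∷ a) p = begin
  (x + sum a + suc k) * P                          ≡⟨ split x (sum a) k P ⟩
  suc x * P + (sum a + k) * P                      ≤⟨ +-mono-≤ ([1+x]*2^p≤2^x+p*2^p x p)
                                                               ([sum+length]*2^p≤sum-2^+length*p*2^p a p) ⟩
  (2 ^ x + p * P) + (sum (map (2 ^_) a) + k * p * P) ≡⟨ merge (2 ^ x) (sum (map (2 ^_) a)) k p P ⟩
  2 ^ x + sum (map (2 ^_) a) + suc k * p * P       ∎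
  where
  open ≤-Reasoning
  P = 2 ^ p
  split : ∀ x s k P → (x + s + suc k) * P ≡ suc x * P + (s + k) * P
  split = solve-∀
  merge : ∀ X S k p P → (X + p * P) + (S + k * p * P) ≡ X + S + suc k * p * P
  merge = solve-∀

sum-2^<[1+length]*2^p⇒sum≤length*p : ∀ {k} (a : Vec ℕ k) p →
  sum (map (2 ^_) a) < (1 + k) * 2 ^ p → sum a ≤ k * p
sum-2^<[1+length]*2^p⇒sum≤length*p {k} a p S<[1+k]P =
  s≤s⁻¹ (+-cancelʳ-< k (sum a) (suc (k * p)) (*-cancelʳ-< P (sum a + k) (suc (k * p) + k) (begin-strict
    (sum a + k) * P                 ≤⟨ [sum+length]*2^p≤sum-2^+length*p*2^p a p ⟩
    sum (map (2 ^_) a) + k * p * P  <⟨ +-monoˡ-< (k * p * P) S<[1+k]P ⟩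
    (1 + k) * P + k * p * P         ≡⟨ regroup k p P ⟩
    (suc (k * p) + k) * P           ∎)))
  where
  open ≤-Reasoning
  P = 2 ^ p
  regroup : ∀ k p P → (1 + k) * P + k * p * P ≡ (suc (k * p) + k) * P
  regroup = solve-∀

sum≤length*[length∸j] : ∀ {k} j (a : Vec ℕ k) → 2 ^ j ≤ k →
  sum (map geom a) ≤ 2 ^ k ∸ 1 → sum a ≤ k * (k ∸ j)
sum≤length*[length∸j] {k} j a 2^j≤k G≤2^k∸1 =
  sum-2^<[1+length]*2^p⇒sum≤length*p a p (begin-strict
    sum (map (2 ^_) a)     ≡⟨ sym (sum-geom+length≡sum-2^ a) ⟩
    sum (map geom a) + k   <⟨ +-monoˡ-< k (≤-<-trans G≤2^k∸1 (∸-monoʳ-< (s≤s z≤n) (m^n>0 2 k))) ⟩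
    2 ^ k + k              ≡⟨ cong (λ i → 2 ^ i + k) (sym (m+[n∸m]≡n (<⇒≤ (2^m≤n⇒m<n {j} 2^j≤k)))) ⟩
    2 ^ (j + p) + k        ≡⟨ cong (_+ k) (^-distribˡ-+-* 2 j p) ⟩
    2 ^ j * 2 ^ p + k      ≤⟨ +-mono-≤ (*-monoˡ-≤ (2 ^ p) 2^j≤k) (2^j≤k⇒k≤2^[k∸j] {j} 2^j≤k) ⟩
    k * 2 ^ p + 2 ^ p      ≡⟨ +-comm (k * 2 ^ p) (2 ^ p) ⟩
    (1 + k) * 2 ^ p        ∎)
  where
  open ≤-Reasoning
  p = k ∸ j

realBound-intro : ∀ {k n} r e → 4 * n ≤ r * r → n ≤ 2 ^ e → 2 * r + e ≤ 4 * k + 2 → RealBound k n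
realBound-intro {k} {n} r e 4n≤r² n≤2^e 2r+e≤4k+2 a b c d _ _ a²≤16nb² 2^c≤n^d = begin
  a * d + c * b               ≤⟨ +-mono-≤ (*-monoˡ-≤ d a≤2rb) (*-monoˡ-≤ b c≤ed) ⟩
  2 * r * b * d + e * d * b   ≡⟨ factor r e b d ⟩
  (2 * r + e) * (b * d)       ≤⟨ *-monoˡ-≤ (b * d) 2r+e≤4k+2 ⟩
  (4 * k + 2) * (b * d)       ∎
  where
  open ≤-Reasoning
  factor : ∀ r e b d → 2 * r * b * d + e * d * b ≡ (2 * r + e) * (b * d)
  factor = solve-∀
  square : ∀ r b → 4 * (r * r) * (b * b) ≡ (2 * r * b) * (2 * r * b)
  square = solve-∀
  a≤2rb : a ≤ 2 * r * b
  a≤2rb = m*m≤n*n⇒m≤n (begin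
    a * a                       ≤⟨ a²≤16nb² ⟩
    16 * n * (b * b)            ≡⟨ cong (_* (b * b)) (*-assoc 4 4 n) ⟩
    4 * (4 * n) * (b * b)       ≤⟨ *-monoˡ-≤ (b * b) (*-monoʳ-≤ 4 4n≤r²) ⟩
    4 * (r * r) * (b * b)       ≡⟨ square r b ⟩
    (2 * r * b) * (2 * r * b)   ∎)
  c≤ed : c ≤ e * d
  c≤ed = 2^m≤2^n⇒m≤n (begin
    2 ^ c                       ≤⟨ 2^c≤n^d ⟩
    n ^ d                       ≤⟨ ^-monoˡ-≤ d n≤2^e ⟩
    (2 ^ e) ^ d                 ≡⟨ ^-*-assoc 2 e d ⟩
    2 ^ (e * d)                 ∎)

lemma11 : ∀ (k n : ℕ) → 1 ≤ k → 1 ≤ n → (a : Vec ℕ k) →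
            sum a ≡ n →
            sum (map geom a) ≤ 2 ^ k ∸ 1 →
            (n ≤ k * k) × RealBound k n
lemma11 k _ k≥1 _ a refl G≤2^k∸1 with log₂-bracket k≥1
... | j , 2^j≤k , k≤2^[1+j] =
  ≤-trans n≤k*p (*-monoʳ-≤ k p≤k) ,
  realBound-intro {k} (k + p) (suc j + suc j) 4n≤[k+p]² n≤2^[2+2j] 2[k+p]+2+2j≤4k+2
  where
  open ≤-Reasoning
  p = k ∸ j
  p≤k : p ≤ k
  p≤k = m∸n≤m k j
  n≤k*p : sum a ≤ k * p
  n≤k*p = sum≤length*[length∸j] j a 2^j≤k G≤2^k∸1
  4n≤[k+p]² : 4 * sum a ≤ (k + p) * (k + p)
  4n≤[k+p]² = ≤-trans (*-monoʳ-≤ 4 n≤k*p) (4*m*n≤[m+n]² k p)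
  n≤2^[2+2j] : sum a ≤ 2 ^ (suc j + suc j)
  n≤2^[2+2j] = begin
    sum a                    ≤⟨ n≤k*p ⟩
    k * p                    ≤⟨ *-mono-≤ k≤2^[1+j] (≤-trans p≤k k≤2^[1+j]) ⟩
    2 ^ suc j * 2 ^ suc j    ≡⟨ sym (^-distribˡ-+-* 2 (suc j) (suc j)) ⟩
    2 ^ (suc j + suc j)      ∎
  2[k+p]+2+2j≤4k+2 : 2 * (k + p) + (suc j + suc j) ≤ 4 * k + 2
  2[k+p]+2+2j≤4k+2 = ≤-reflexive
    (subst (λ m → 2 * (m + p) + (suc j + suc j) ≡ 4 * m + 2) (m+[n∸m]≡n (<⇒≤ (2^m≤n⇒m<n {j} 2^j≤k))) (identity j p))
    where
    identity : ∀ j p → 2 * ((j + p) + p) + (suc j + suc j) ≡ 4 * (j + p) + 2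
    identity = solve-∀
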